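{- Let $G=(V,E)$ be a finite, undirected, unweighted, simple, connected graph with $N\ge 2$ nodes and $M\ge 1$ edges, with degree sequence $d_1\ge\dots\ge d_N$ in non-increasing order and density $\delta=\frac{2M}{N(N-1)}$. Let $n_1\in\{0,\dots,N\}$, $n_0=N-n_1$, and let each node carry a characteristic $c_i\in\{0,1\}$ with exactly $n_1$ nodes having $c_i=1$. Let $m_{11}$ be the number of edges with both endpoints of characteristic $1$ and $m_{10}$ the number of edges with endpoints of different characteristics. Define $\overline{m}_{11}=\frac{n_1(n_1-1)}{2}\delta$, $\overline{m}_{10}=n_1(N-n_1)\delta$, the dyadicity $D=m_{11}/\overline{m}_{11}$ (when $n_1\ge 2$) and the heterophilicity $H=m_{10}/\overline{m}_{10}$ (when $1\le n_1\le N-1$). Define $UBm_{11}=\min\big(M,\binom{n_1}{2},\lceil\sum_{i=1}^{n_1}\min(d_i,n_1-1)/2\rceil\big)$, $UBm_{10}=\min\big(M,n_1n_0,\min(\sum_{i=1}^{n_1}\min(d_i,n_0),\sum_{i=1}^{n_0}\min(d_i,n_1))\big)$, $LBm_{11}=\max\big(0,\lfloor(\sum_{i=N-n_1+1}^{N}d_i-\sum_{i=1}^{n_0}d_i)/2\rfloor\big)$, and $LBm_{10}=0$ if $n_1\in\{0,N\}$, $LBm_{10}=\max\big(1,\sum_{i=N-n_1+1}^{N}d_i-n_1(n_1-1)\big)$ if $0<n_1<N$. Let $D_{min}=LBm_{11}/\overline{m}_{11}$, $D_{max}=UBm_{11}/\overline{m}_{11}$, $H_{min}=LBm_{10}/\overline{m}_{10}$,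 $H_{max}=UBm_{10}/\overline{m}_{10}$. Then $D_{min}\le D\le D_{max}$ whenever $n_1\ge 2$, and $H_{min}\le H\le H_{max}$ whenever $1\le n_1\le N-1$.
   Context: The degree $d_i$ of a node is the number of edges incident to it. Sums $\sum_{i=1}^{k}d_i$ are over the $k$ largest degrees and $\sum_{i=N-k+1}^{N}d_i$ over the $k$ smallest degrees; empty sums are $0$. -}

module Defs where

open import Data.Nat as ℕ using (ℕ; zero; suc; _∸_; _<ᵇ_)
open import Data.Bool using (Bool; true; false; if_then_else_; _∧_; not; _xor_)
open import Data.Fin using (Fin; toℕ)
open import Data.List using (List; []; _∷_; map; allFin; take; drop; length)
open import Data.Nat.ListAction using (sum)
open import Data.Integer as ℤ using (ℤ; +_)
import Data.Integer.DivMod as ℤDM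
open import Data.Rational as ℚ using (ℚ; 0ℚ)
open import Data.Rational.Properties using (_≟_)
open import Data.Product using (∃)
open import Relation.Nullary using (yes; no)
open import Relation.Binary.PropositionalEquality using (_≡_)

b2n : Bool → ℕ
b2n true  = 1
b2n false = 0

record Graph (N : ℕ) : Set where
  field
    adj     : Fin N → Fin N → Bool
    sym     : ∀ i j → adj i j ≡ adj j i
    irrefl  : ∀ i → adj i i ≡ false
open Graph public

data Walk {N : ℕ} (G : Graph N) : Fin N → Fin N → Set where
  here  : ∀ {u} → Walk G u u
  step  : ∀ {u w v} → adj G u w ≡ true → Walk G w v → Walk G u v

Connected : ∀ {N} → Graph N → Set
Connected {N} G = ∀ (u v : Fin N) → Walk G u v

degree : ∀ {N} → Graph N → Fin N → ℕ
degree {N} G i = sum (map (λ j → b2n (adj G i j)) (allFin N))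

countEdgesWith : ∀ {N} → Graph N → (Fin N → Fin N → Bool) → ℕ
countEdgesWith {N} G P =
  sum (map (λ i → sum (map (λ j → b2n ((toℕ i <ᵇ toℕ j) ∧ adj G i j ∧ P i j))
                           (allFin N)))
           (allFin N))

numEdges : ∀ {N} → Graph N → ℕ
numEdges G = countEdgesWith G (λ _ _ → true)

degreeList : ∀ {N} → Graph N → List ℕ
degreeList {N} G = map (degree G) (allFin N)

count1 : ∀ {N} → (Fin N → Bool) → ℕ
count1 {N} c = sum (map (λ i → b2n (c i)) (allFin N))

m11 : ∀ {N} → Graph N → (Fin N → Bool) → ℕ
m11 G c = countEdgesWith G (λ i j → c i ∧ c j)

m10 : ∀ {N} → Graph N → (Fin N → Bool) → ℕ
m10 G c = countEdgesWith G (λ i j → c i xor c j)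

-- Given the degree sequence ds = d_1 ≥ ... ≥ d_N as a list:
-- sum of the k largest degrees  Σ_{i=1}^{k} d_i
sumLargest : List ℕ → ℕ → ℕ
sumLargest ds k = sum (take k ds)

-- sum of the k smallest degrees  Σ_{i=N-k+1}^{N} d_i
sumSmallest : List ℕ → ℕ → ℕ
sumSmallest ds k = sum (drop (length ds ∸ k) ds)

sumLargestMin : List ℕ → ℕ → ℕ → ℕ
sumLargestMin ds k a = sum (map (λ d → d ℕ.⊓ a) (take k ds))

ℕtoℚ : ℕ → ℚ
ℕtoℚ n = (+ n) ℚ./ 1

ℤtoℚ : ℤ → ℚ
ℤtoℚ z = z ℚ./ 1

-- division of rationals; only ever used with non-zero denominator
-- (the returned value for a zero denominator, 0, is irrelevant)
_÷?_ : ℚ → ℚ → ℚ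
p ÷? q with q ≟ 0ℚ
... | yes _ = 0ℚ
... | no q≢0 = ℚ._÷_ p q {{ℚ.≢-nonZero q≢0}}

density : ℕ → ℕ → ℚ
density N M = ℕtoℚ (2 ℕ.* M) ÷? ℕtoℚ (N ℕ.* (N ∸ 1))

mbar11 : ℕ → ℕ → ℕ → ℚ
mbar11 N M n1 = (ℕtoℚ (n1 ℕ.* (n1 ∸ 1)) ÷? ℕtoℚ 2) ℚ.* density N M

mbar10 : ℕ → ℕ → ℕ → ℚ
mbar10 N M n1 = ℕtoℚ (n1 ℕ.* (N ∸ n1)) ℚ.* density N M

choose2 : ℕ → ℕ
choose2 n = (n ℕ.* (n ∸ 1)) ℕ./ 2

UBm11 : (N M n1 : ℕ) → List ℕ → ℕ
UBm11 N M n1 ds =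
  M ℕ.⊓ (choose2 n1 ℕ.⊓ ((sumLargestMin ds n1 (n1 ∸ 1) ℕ.+ 1) ℕ./ 2))
  -- ⌈s/2⌉ = ⌊(s+1)/2⌋ for s ∈ ℕ

UBm10 : (N M n1 : ℕ) → List ℕ → ℕ
UBm10 N M n1 ds =
  M ℕ.⊓ ((n1 ℕ.* n0) ℕ.⊓ (sumLargestMin ds n1 n0 ℕ.⊓ sumLargestMin ds n0 n1))
  where n0 = N ∸ n1

LBm11 : (N M n1 : ℕ) → List ℕ → ℤ
LBm11 N M n1 ds =
  + 0 ℤ.⊔ ((+ sumSmallest ds n1 ℤ.- + sumLargest ds (N ∸ n1)) ℤDM./ℕ 2)

LBm10 : (N M n1 : ℕ) → List ℕ → ℤ
LBm10 N M n1 ds with n1 ℕ.≟ 0 | n1 ℕ.≟ N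
... | yes _ | _     = + 0
... | no _  | yes _ = + 0
... | no _  | no _  = + 1 ℤ.⊔ (+ sumSmallest ds n1 ℤ.- + (n1 ℕ.* (n1 ∸ 1)))

module Submission where

-- Let P(c, c′) count the ordered pairs (i, j) of adjacent nodes with i in class c and j in class c′.
-- By the handshake lemma 2 m₁₁ = P(1, 1) and m₁₀ = P(1, 0) = P(0, 1), and P(c, c′) is the sum, over
-- the nodes of class c, of their numbers of neighbours in class c′. Bounding these summands by
-- min(dᵢ, n₁ − 1), min(dᵢ, n₀) and min(dᵢ, n₁), and using that a monotone function of the degrees
-- summed over any n nodes is at most its sum over the n largest degrees, gives the upper bounds.
-- For the lower bounds, the degrees of the class-1 nodes add up to 2 m₁₁ + m₁₀ and are at least the
-- n₁ smallest degrees, while m₁₀ is at most the sum of the n₀ largest degrees and 2 m₁₁ ≤ n₁(n₁ − 1);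
-- connectivity yields an edge between the classes, so m₁₀ ≥ 1. Dividing by the common
-- non-negative denominator m̄ preserves all these inequalities.

open import Defs hiding (sym)
open import Algebra.Properties.CommutativeSemigroup as CommutativeSemigroup using ()
open import Data.Bool using (Bool; true; false; not; _∧_; _xor_; T)
open import Data.Bool.Properties using (∧-comm; xor-comm; not-injective; T-≡)
open import Data.Empty using (⊥-elim)
open import Data.Fin using (Fin; toℕ)
open import Data.Fin.Properties using (toℕ-injective)
import Data.Integer as ℤ
import Data.Integer.DivMod as ℤ
import Data.Integer.Properties as ℤ
open import Data.List using (List; []; _∷_; _++_; map; allFin; filter; take; drop; length)
open import Data.List.Membership.Propositional using (_∈_)
open import Data.List.Membership.Propositional.Properties using (∈-allFin)
open import Data.List.Properties
  using (length-tabulate; length-map; map-∘; map-id; take-map; take++drop≡id)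
open import Data.List.Relation.Binary.Permutation.Propositional as ↭ using (_↭_; ↭-sym)
import Data.List.Relation.Binary.Permutation.Propositional.Properties as ↭
open import Data.List.Relation.Binary.Sublist.Propositional using (_⊆_; []; _∷_; _∷ʳ_)
open import Data.List.Relation.Binary.Sublist.Propositional.Properties using (map⁺; filter-⊆)
open import Data.List.Relation.Unary.All using (All; []; _∷_)
open import Data.List.Relation.Unary.Any using (here; there)
open import Data.List.Relation.Unary.Linked as Linked using (Linked)
import Data.List.Relation.Unary.Linked.Properties as Linked
import Data.Nat.Coprimality as Coprime
open import Data.Nat as ℕ using (ℕ; zero; suc; _+_; _*_; _∸_; _≤_; _≥_; _⊓_; _<ᵇ_; z≤n)
open import Data.Nat.DivMod using (m*n/n≡m; /-monoˡ-≤)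
open import Data.Nat.ListAction using (sum)
open import Data.Nat.ListAction.Properties using (sum-↭; sum-++)
open import Data.Nat.Properties
open import Data.Product using (∃; ∃₂; _×_; _,_)
open import Data.Rational as ℚ using (0ℚ; mkℚ; NonNegative) renaming (_≤_ to _≤ℚ_)
import Data.Rational.Properties as ℚ
open import Function using (_∘_)
open import Function.Bundles using (Equivalence)
open import Relation.Nullary using (yes; no)
open import Relation.Nullary.Decidable using (T?)
open import Relation.Binary.PropositionalEquality

open CommutativeSemigroup +-commutativeSemigroup using (interchange; x∙yz≈y∙xz)

private variable
  A B : Set

sum-map-+ : (f g : A → ℕ) (xs : List A) →
            sum (map (λ x → f x + g x) xs) ≡ sum (map f xs) + sum (map g xs)
sum-map-+ f g []       = refl
sum-map-+ f g (x ∷ xs) =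
  trans (cong (f x + g x +_) (sum-map-+ f g xs))
        (interchange (f x) (g x) (sum (map f xs)) (sum (map g xs)))

sum-map-cong : {f g : A → ℕ} → (∀ x → f x ≡ g x) → ∀ xs → sum (map f xs) ≡ sum (map g xs)
sum-map-cong f≡g []       = refl
sum-map-cong f≡g (x ∷ xs) = cong₂ _+_ (f≡g x) (sum-map-cong f≡g xs)

sum-map-mono : {f g : A → ℕ} → (∀ x → f x ≤ g x) → ∀ xs → sum (map f xs) ≤ sum (map g xs)
sum-map-mono f≤g []       = z≤n
sum-map-mono f≤g (x ∷ xs) = +-mono-≤ (f≤g x) (sum-map-mono f≤g xs)

sum-map-*ˡ : ∀ k (f : A → ℕ) xs → sum (map (λ x → k * f x) xs) ≡ k * sum (map f xs)
sum-map-*ˡ k f []       = sym (*-zeroʳ k)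
sum-map-*ˡ k f (x ∷ xs) =
  trans (cong (k * f x +_) (sum-map-*ˡ k f xs)) (sym (*-distribˡ-+ k (f x) (sum (map f xs))))

sum-map-const : ∀ k (xs : List A) → sum (map (λ _ → k) xs) ≡ length xs * k
sum-map-const k []       = refl
sum-map-const k (x ∷ xs) = cong (k +_) (sum-map-const k xs)

sum-map-comm : (f : A → B → ℕ) (xs : List A) (ys : List B) →
               sum (map (λ x → sum (map (f x) ys)) xs) ≡ sum (map (λ y → sum (map (λ x → f x y) xs)) ys)
sum-map-comm f []       ys = sym (trans (sum-map-const 0 ys) (*-zeroʳ (length ys)))
sum-map-comm f (x ∷ xs) ys =
  trans (cong (sum (map (f x) ys) +_) (sum-map-comm f xs ys))
        (sym (sum-map-+ (f x) (λ y → sum (map (λ x → f x y) xs)) ys))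

∈⇒≤sum-map : (f : A → ℕ) {x : A} {xs : List A} → x ∈ xs → f x ≤ sum (map f xs)
∈⇒≤sum-map f {xs = y ∷ ys} (here refl) = m≤m+n (f y) (sum (map f ys))
∈⇒≤sum-map f {xs = y ∷ ys} (there x∈ys) = ≤-trans (∈⇒≤sum-map f x∈ys) (m≤n+m _ (f y))

sum-map-mono-with-gap : {f g : A → ℕ} → (∀ y → f y ≤ g y) → {x : A} {xs : List A} →
                        x ∈ xs → f x ≡ 0 → g x + sum (map f xs) ≤ sum (map g xs)
sum-map-mono-with-gap f≤g {xs = y ∷ ys} (here refl) fx≡0 rewrite fx≡0 =
  +-monoʳ-≤ _ (sum-map-mono f≤g ys)
sum-map-mono-with-gap {f = f} {g} f≤g {x} {y ∷ ys} (there x∈ys) fx≡0 = begin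
  g x + (f y + sum (map f ys)) ≡⟨ x∙yz≈y∙xz (g x) (f y) _ ⟩
  f y + (g x + sum (map f ys)) ≤⟨ +-mono-≤ (f≤g y) (sum-map-mono-with-gap f≤g x∈ys fx≡0) ⟩
  g y + sum (map g ys)         ∎
  where open ≤-Reasoning

sum-map-filter : (c : A → Bool) (f : A → ℕ) (xs : List A) →
                 sum (map (λ x → b2n (c x) * f x) xs) ≡ sum (map f (filter (T? ∘ c) xs))
sum-map-filter c f []       = refl
sum-map-filter c f (x ∷ xs) with c x
... | true  = cong₂ _+_ (+-identityʳ (f x)) (sum-map-filter c f xs)
... | false = sum-map-filter c f xs

sum-b2n≡length-filter : (c : A → Bool) (xs : List A) →
                        sum (map (b2n ∘ c) xs) ≡ length (filter (T? ∘ c) xs)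
sum-b2n≡length-filter c []       = refl
sum-b2n≡length-filter c (x ∷ xs) with c x
... | true  = cong suc (sum-b2n≡length-filter c xs)
... | false = sum-b2n≡length-filter c xs

sum-map-filter-mono : (c : A → Bool) {f g : A → ℕ} → (∀ x → c x ≡ true → f x ≤ g x) → ∀ xs →
                      sum (map f (filter (T? ∘ c) xs)) ≤ sum (map g (filter (T? ∘ c) xs))
sum-map-filter-mono c f≤g []       = z≤n
sum-map-filter-mono c f≤g (x ∷ xs) with c x in cx
... | true  = +-mono-≤ (f≤g x cx) (sum-map-filter-mono c f≤g xs)
... | false = sum-map-filter-mono c f≤g xs

sum-map-filter-split : (c : A → Bool) (f : A → ℕ) (xs : List A) →
                       sum (map f (filter (T? ∘ c) xs)) + sum (map f (filter (T? ∘ (not ∘ c)) xs))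
                       ≡ sum (map f xs)
sum-map-filter-split c f []       = refl
sum-map-filter-split c f (x ∷ xs) with c x
... | true  = trans (+-assoc (f x) _ _) (cong (f x +_) (sum-map-filter-split c f xs))
... | false = trans (x∙yz≈y∙xz (sum (map f (filter (T? ∘ c) xs))) (f x) _)
                      (cong (f x +_) (sum-map-filter-split c f xs))

⊆-↭-commute : {xs ys zs : List A} → xs ⊆ ys → ys ↭ zs → ∃ λ ws → xs ↭ ws × ws ⊆ zs
⊆-↭-commute xs⊆ys ↭.refl = _ , ↭.refl , xs⊆ys
⊆-↭-commute (y ∷ʳ xs⊆ys) (↭.prep y ys↭zs) with ⊆-↭-commute xs⊆ys ys↭zs
... | ws , xs↭ws , ws⊆zs = ws , xs↭ws , y ∷ʳ ws⊆zs
⊆-↭-commute (refl ∷ xs⊆ys) (↭.prep y ys↭zs) with ⊆-↭-commute xs⊆ys ys↭zs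
... | ws , xs↭ws , ws⊆zs = y ∷ ws , ↭.prep y xs↭ws , refl ∷ ws⊆zs
⊆-↭-commute (x ∷ʳ y ∷ʳ xs⊆ys) (↭.swap x y ys↭zs) with ⊆-↭-commute xs⊆ys ys↭zs
... | ws , xs↭ws , ws⊆zs = ws , xs↭ws , y ∷ʳ x ∷ʳ ws⊆zs
⊆-↭-commute (x ∷ʳ refl ∷ xs⊆ys) (↭.swap x y ys↭zs) with ⊆-↭-commute xs⊆ys ys↭zs
... | ws , xs↭ws , ws⊆zs = y ∷ ws , ↭.prep y xs↭ws , refl ∷ x ∷ʳ ws⊆zs
⊆-↭-commute (refl ∷ y ∷ʳ xs⊆ys) (↭.swap x y ys↭zs) with ⊆-↭-commute xs⊆ys ys↭zs
... | ws , xs↭ws , ws⊆zs = x ∷ ws , ↭.prep x xs↭ws , y ∷ʳ refl ∷ ws⊆zs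
⊆-↭-commute (refl ∷ refl ∷ xs⊆ys) (↭.swap x y ys↭zs) with ⊆-↭-commute xs⊆ys ys↭zs
... | ws , xs↭ws , ws⊆zs = y ∷ x ∷ ws , ↭.swap x y xs↭ws , refl ∷ refl ∷ ws⊆zs
⊆-↭-commute xs⊆ys (↭.trans ys↭us us↭zs) with ⊆-↭-commute xs⊆ys ys↭us
... | vs , xs↭vs , vs⊆us with ⊆-↭-commute vs⊆us us↭zs
... | ws , vs↭ws , ws⊆zs = ws , ↭.trans xs↭vs vs↭ws , ws⊆zs

sum-take-≤-cons : ∀ {d ys} → All (_≤ d) ys → ∀ k → sum (take k ys) ≤ sum (take k (d ∷ ys))
sum-take-≤-cons _                            zero          = z≤n
sum-take-≤-cons []                           (suc _)       = z≤n
sum-take-≤-cons (y≤d ∷ _)                    (suc zero)    = +-monoˡ-≤ 0 y≤d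
sum-take-≤-cons {d} {y ∷ ys} (y≤d ∷ ys≤d) (suc (suc k)) = begin
  y + sum (take (suc k) ys)  ≤⟨ +-monoʳ-≤ y (sum-take-≤-cons ys≤d (suc k)) ⟩
  y + (d + sum (take k ys))  ≡⟨ x∙yz≈y∙xz y d _ ⟩
  d + (y + sum (take k ys))  ∎
  where open ≤-Reasoning

sum-⊆-sorted-≤ : ∀ {xs ds} → Linked _≥_ ds → xs ⊆ ds → sum xs ≤ sum (take (length xs) ds)
sum-⊆-sorted-≤ _      []               = z≤n
sum-⊆-sorted-≤ sorted (refl ∷ xs⊆ds)   = +-monoʳ-≤ _ (sum-⊆-sorted-≤ (Linked.tail sorted) xs⊆ds)
sum-⊆-sorted-≤ {xs} sorted (d ∷ʳ xs⊆ds) =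
  ≤-trans (sum-⊆-sorted-≤ (Linked.tail sorted) xs⊆ds)
          (sum-take-≤-cons (below sorted) (length xs))
  where
  below : ∀ {d ds} → Linked _≥_ (d ∷ ds) → All (_≤ d) ds
  below Linked.[-]        = []
  below (d≥d′ Linked.∷ l) = Linked.Linked⇒All (λ a≥b b≥c → ≤-trans b≥c a≥b) d≥d′ l

sum-⊆-↭-sorted-≤ : ∀ {xs ys ds} → xs ⊆ ys → ys ↭ ds → Linked _≥_ ds →
                   sum xs ≤ sum (take (length xs) ds)
sum-⊆-↭-sorted-≤ {xs} {ds = ds} xs⊆ys ys↭ds sorted with ⊆-↭-commute xs⊆ys ys↭ds
... | ws , xs↭ws , ws⊆ds = begin
  sum xs                         ≡⟨ sum-↭ xs↭ws ⟩
  sum ws                         ≤⟨ sum-⊆-sorted-≤ sorted ws⊆ds ⟩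
  sum (take (length ws) ds)      ≡⟨ cong (λ k → sum (take k ds)) (↭.↭-length xs↭ws) ⟨
  sum (take (length xs) ds)      ∎
  where open ≤-Reasoning

sum-b2n-pos⇒∃ : (c : A → Bool) (xs : List A) → 1 ≤ sum (map (b2n ∘ c) xs) → ∃ λ x → c x ≡ true
sum-b2n-pos⇒∃ c (x ∷ xs) pos with c x in cx
... | true  = x , cx
... | false = sum-b2n-pos⇒∃ c xs pos

m+n≡o+p∧n≤o⇒p≤m : ∀ {m n o p} → m + n ≡ o + p → n ≤ o → p ≤ m
m+n≡o+p∧n≤o⇒p≤m {m} {n} {o} {p} m+n≡o+p n≤o = +-cancelˡ-≤ o p m (begin
  o + p  ≡⟨ m+n≡o+p ⟨
  m + n  ≤⟨ +-monoʳ-≤ m n≤o ⟩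
  m + o  ≡⟨ +-comm m o ⟩
  o + m  ∎)
  where open ≤-Reasoning

b2n-∧-≤ : ∀ a x → b2n (a ∧ x) ≤ b2n x
b2n-∧-≤ true  _ = ≤-refl
b2n-∧-≤ false _ = z≤n

∑ : ∀ {N} → (Fin N → ℕ) → ℕ
∑ {N} f = sum (map f (allFin N))

members : ∀ {N} → (Fin N → Bool) → List (Fin N)
members {N} c = filter (T? ∘ c) (allFin N)

∑∈ : ∀ {N} → (Fin N → Bool) → (Fin N → ℕ) → ℕ
∑∈ c f = sum (map f (members c))

b2n-∧-<ᵇ-split : ∀ {N} (R : Fin N → Fin N → Bool) → (∀ i j → R i j ≡ R j i) → (∀ i → R i i ≡ false) →
                 ∀ i j → b2n (R i j) ≡ b2n ((toℕ i <ᵇ toℕ j) ∧ R i j) + b2n ((toℕ j <ᵇ toℕ i) ∧ R j i)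
b2n-∧-<ᵇ-split R R-sym R-irrefl i j with toℕ i <ᵇ toℕ j in i<j | toℕ j <ᵇ toℕ i in j<i
... | true  | true  = ⊥-elim (<-asym (<ᵇ⇒< (toℕ i) (toℕ j) (Equivalence.from T-≡ i<j))
                                   (<ᵇ⇒< (toℕ j) (toℕ i) (Equivalence.from T-≡ j<i)))
... | true  | false = sym (+-identityʳ _)
... | false | true  = cong b2n (R-sym i j)
... | false | false = trans (cong (b2n ∘ R i) (sym i≡j)) (cong b2n (R-irrefl i))
  where
  i≡j : i ≡ j
  i≡j = toℕ-injective (≤-antisym (≮⇒≥ (subst T j<i ∘ <⇒<ᵇ)) (≮⇒≥ (subst T i<j ∘ <⇒<ᵇ)))

∑∑-+ : ∀ {N} (f g : Fin N → Fin N → ℕ) →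
       ∑ (λ i → ∑ λ j → f i j + g i j) ≡ ∑ (λ i → ∑ (f i)) + ∑ (λ i → ∑ (g i))
∑∑-+ {N} f g = trans (sum-map-cong (λ i → sum-map-+ (f i) (g i) (allFin N)) (allFin N))
                     (sum-map-+ (λ i → ∑ (f i)) (λ i → ∑ (g i)) (allFin N))

∑∑-cong : ∀ {N} {f g : Fin N → Fin N → ℕ} → (∀ i j → f i j ≡ g i j) →
          ∑ (λ i → ∑ (f i)) ≡ ∑ (λ i → ∑ (g i))
∑∑-cong {N} f≡g = sum-map-cong (λ i → sum-map-cong (f≡g i) (allFin N)) (allFin N)

handshake : ∀ {N} (R : Fin N → Fin N → Bool) → (∀ i j → R i j ≡ R j i) → (∀ i → R i i ≡ false) →
            2 * ∑ (λ i → ∑ λ j → b2n ((toℕ i <ᵇ toℕ j) ∧ R i j)) ≡ ∑ (λ i → ∑ λ j → b2n (R i j))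
handshake {N} R R-sym R-irrefl = sym (begin
  ∑ (λ i → ∑ λ j → b2n (R i j))     ≡⟨ ∑∑-cong (b2n-∧-<ᵇ-split R R-sym R-irrefl) ⟩
  ∑ (λ i → ∑ λ j → R< i j + R< j i)  ≡⟨ ∑∑-+ R< (λ i j → R< j i) ⟩
  S + ∑ (λ i → ∑ λ j → R< j i)       ≡⟨ cong (S +_) (sum-map-comm (λ j i → R< i j) L L) ⟩
  S + S                              ≡⟨ cong (S +_) (+-identityʳ S) ⟨
  2 * S                              ∎)
  where
  open ≡-Reasoning
  R< : Fin N → Fin N → ℕ
  R< i j = b2n ((toℕ i <ᵇ toℕ j) ∧ R i j)
  S : ℕ
  S = ∑ (λ i → ∑ (R< i))
  L : List (Fin N)
  L = allFin N

count1≡length-members : ∀ {N} (c : Fin N → Bool) → count1 c ≡ length (members c)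
count1≡length-members {N} c = sum-b2n≡length-filter c (allFin N)

∑∈-const : ∀ {N} (c : Fin N → Bool) k → ∑∈ c (λ _ → k) ≡ count1 c * k
∑∈-const c k = trans (sum-map-const k (members c)) (cong (_* k) (sym (count1≡length-members c)))

∑∈-+-∑∈-not : ∀ {N} (c : Fin N → Bool) (f : Fin N → ℕ) → ∑∈ c f + ∑∈ (not ∘ c) f ≡ ∑ f
∑∈-+-∑∈-not {N} c f = sum-map-filter-split c f (allFin N)

count1+count1-not : ∀ {N} (c : Fin N → Bool) → count1 c + count1 (not ∘ c) ≡ N
count1+count1-not {N} c = begin
  count1 c + count1 (not ∘ c)            ≡⟨ sum-map-+ (b2n ∘ c) (b2n ∘ not ∘ c) (allFin N) ⟨
  ∑ (λ i → b2n (c i) + b2n (not (c i)))  ≡⟨ sum-map-cong (b2n+b2n-not ∘ c) (allFin N) ⟩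
  ∑ {N} (λ _ → 1)                        ≡⟨ trans (sum-map-const 1 (allFin N)) (*-identityʳ _) ⟩
  length (allFin N)                      ≡⟨ length-tabulate (λ i → i) ⟩
  N                                      ∎
  where
  open ≡-Reasoning
  b2n+b2n-not : ∀ b → b2n b + b2n (not b) ≡ 1
  b2n+b2n-not true  = refl
  b2n+b2n-not false = refl

count1-not≡∸ : ∀ {N} (c : Fin N → Bool) → count1 (not ∘ c) ≡ N ∸ count1 c
count1-not≡∸ {N} c = trans (sym (m+n∸m≡n (count1 c) _)) (cong (_∸ count1 c) (count1+count1-not c))

count1-not-pos : ∀ {N} (c : Fin N → Bool) → 1 ≤ count1 c → count1 c ≤ N ∸ 1 → 1 ≤ count1 (not ∘ c)
count1-not-pos {N} c n1>0 n1≤N∸1 =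
  subst (1 ≤_) (sym (count1-not≡∸ c)) (m<n⇒0<n∸m (≤-<-trans n1≤N∸1 (∸-monoʳ-< {N} {1} {0} ≤-refl N>0)))
  where
  N>0 : 1 ≤ N
  N>0 = ≤-trans n1>0 (≤-trans n1≤N∸1 (m∸n≤m N 1))

module _ {N} (G : Graph N) where

  degreeInto : (Fin N → Bool) → Fin N → ℕ
  degreeInto c i = ∑ λ j → b2n (adj G i j ∧ c j)

  pairsBetween : (Fin N → Bool) → (Fin N → Bool) → ℕ
  pairsBetween c c′ = ∑ λ i → ∑ λ j → b2n (adj G i j ∧ c i ∧ c′ j)

  countEdgesWith-≤-numEdges : ∀ P → countEdgesWith G P ≤ numEdges G
  countEdgesWith-≤-numEdges P =
    sum-map-mono (λ i → sum-map-mono (λ j → drop-P (toℕ i <ᵇ toℕ j) (adj G i j) (P i j)) (allFin N))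
                 (allFin N)
    where
    drop-P : ∀ x a p → b2n (x ∧ a ∧ p) ≤ b2n (x ∧ a ∧ true)
    drop-P true  true  true  = ≤-refl
    drop-P true  true  false = z≤n
    drop-P true  false _     = z≤n
    drop-P false _     _     = z≤n

  degree≡degreeInto+degreeInto-not : ∀ c i → degree G i ≡ degreeInto c i + degreeInto (not ∘ c) i
  degree≡degreeInto+degreeInto-not c i =
    trans (sum-map-cong (λ j → b2n-split (adj G i j) (c j)) (allFin N)) (sum-map-+ _ _ (allFin N))
    where
    b2n-split : ∀ a x → b2n a ≡ b2n (a ∧ x) + b2n (a ∧ not x)
    b2n-split true  true  = refl
    b2n-split true  false = refl
    b2n-split false _     = refl

  degreeInto-≤-degree : ∀ c i → degreeInto c i ≤ degree G i
  degreeInto-≤-degree c i =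
    subst (degreeInto c i ≤_) (sym (degree≡degreeInto+degreeInto-not c i)) (m≤m+n _ _)

  degreeInto-≤-count1 : ∀ c i → degreeInto c i ≤ count1 c
  degreeInto-≤-count1 c i = sum-map-mono (λ j → b2n-∧-≤ (adj G i j) (c j)) (allFin N)

  degreeInto-self-≤ : ∀ c i → c i ≡ true → degreeInto c i ≤ count1 c ∸ 1
  degreeInto-self-≤ c i ci = ∸-monoˡ-≤ 1 (subst (λ b → b2n b + degreeInto c i ≤ count1 c) ci
    (sum-map-mono-with-gap (λ j → b2n-∧-≤ (adj G i j) (c j)) (∈-allFin i)
                           (cong (λ a → b2n (a ∧ c i)) (irrefl G i))))

  twice-m11≡pairsBetween : ∀ c → 2 * m11 G c ≡ pairsBetween c c
  twice-m11≡pairsBetween c =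
    handshake (λ i j → adj G i j ∧ c i ∧ c j)
              (λ i j → cong₂ _∧_ (Graph.sym G i j) (∧-comm (c i) (c j)))
              (λ i → cong (_∧ c i ∧ c i) (irrefl G i))

  twice-m10≡pairsBetween : ∀ c → 2 * m10 G c ≡ pairsBetween c (not ∘ c) + pairsBetween (not ∘ c) c
  twice-m10≡pairsBetween c =
    trans (handshake (λ i j → adj G i j ∧ (c i xor c j))
                     (λ i j → cong₂ _∧_ (Graph.sym G i j) (xor-comm (c i) (c j)))
                     (λ i → cong (_∧ (c i xor c i)) (irrefl G i)))
          (trans (∑∑-cong (λ i j → b2n-∧-xor (adj G i j) (c i) (c j)))
                 (∑∑-+ (λ i j → b2n (adj G i j ∧ c i ∧ not (c j)))
                       (λ i j → b2n (adj G i j ∧ not (c i) ∧ c j))))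
    where
    b2n-∧-xor : ∀ a x y → b2n (a ∧ (x xor y)) ≡ b2n (a ∧ x ∧ not y) + b2n (a ∧ not x ∧ y)
    b2n-∧-xor true  true  true  = refl
    b2n-∧-xor true  true  false = refl
    b2n-∧-xor true  false true  = refl
    b2n-∧-xor true  false false = refl
    b2n-∧-xor false _     _     = refl

  pairsBetween-comm : ∀ c c′ → pairsBetween c c′ ≡ pairsBetween c′ c
  pairsBetween-comm c c′ =
    trans (sum-map-comm (λ i j → b2n (adj G i j ∧ c i ∧ c′ j)) (allFin N) (allFin N))
          (∑∑-cong (λ j i → cong₂ (λ a b → b2n (a ∧ b)) (Graph.sym G i j) (∧-comm (c i) (c′ j))))

  m10≡pairsBetween : ∀ c → m10 G c ≡ pairsBetween c (not ∘ c)
  m10≡pairsBetween c = *-cancelˡ-≡ _ _ 2 (begin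
    2 * m10 G c                   ≡⟨ twice-m10≡pairsBetween c ⟩
    P + pairsBetween (not ∘ c) c  ≡⟨ cong (P +_) (pairsBetween-comm (not ∘ c) c) ⟩
    P + P                         ≡⟨ cong (P +_) (+-identityʳ P) ⟨
    2 * P                         ∎)
    where
    open ≡-Reasoning
    P : ℕ
    P = pairsBetween c (not ∘ c)

  m10≡pairsBetween-not : ∀ c → m10 G c ≡ pairsBetween (not ∘ c) c
  m10≡pairsBetween-not c = trans (m10≡pairsBetween c) (pairsBetween-comm c (not ∘ c))

  pairsBetween≡∑∈ : ∀ c c′ → pairsBetween c c′ ≡ ∑∈ c (degreeInto c′)
  pairsBetween≡∑∈ c c′ = begin
    pairsBetween c c′
      ≡⟨ ∑∑-cong (λ i j → b2n-∧-∧ (adj G i j) (c i) (c′ j)) ⟩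
    ∑ (λ i → ∑ λ j → b2n (c i) * b2n (adj G i j ∧ c′ j))
      ≡⟨ sum-map-cong (λ i → sum-map-*ˡ (b2n (c i)) _ (allFin N)) (allFin N) ⟩
    ∑ (λ i → b2n (c i) * degreeInto c′ i)
      ≡⟨ sum-map-filter c (degreeInto c′) (allFin N) ⟩
    ∑∈ c (degreeInto c′)
      ∎
    where
    open ≡-Reasoning
    b2n-∧-∧ : ∀ a x y → b2n (a ∧ x ∧ y) ≡ b2n x * b2n (a ∧ y)
    b2n-∧-∧ true  true  true  = refl
    b2n-∧-∧ true  true  false = refl
    b2n-∧-∧ true  false _     = refl
    b2n-∧-∧ false true  _     = refl
    b2n-∧-∧ false false _     = refl

  pairsBetween-≤-count1* : ∀ c c′ b → (∀ i → c i ≡ true → degreeInto c′ i ≤ b) →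
                           pairsBetween c c′ ≤ count1 c * b
  pairsBetween-≤-count1* c c′ b bound = begin
    pairsBetween c c′     ≡⟨ pairsBetween≡∑∈ c c′ ⟩
    ∑∈ c (degreeInto c′)  ≤⟨ sum-map-filter-mono c bound (allFin N) ⟩
    ∑∈ c (λ _ → b)        ≡⟨ ∑∈-const c b ⟩
    count1 c * b          ∎
    where open ≤-Reasoning

  ∑∈-degree≡pairsBetween+pairsBetween : ∀ c →
    ∑∈ c (degree G) ≡ pairsBetween c c + pairsBetween c (not ∘ c)
  ∑∈-degree≡pairsBetween+pairsBetween c = begin
    ∑∈ c (degree G)
      ≡⟨ sum-map-cong (degree≡degreeInto+degreeInto-not c) (members c) ⟩
    ∑∈ c (λ i → degreeInto c i + degreeInto (not ∘ c) i)
      ≡⟨ sum-map-+ (degreeInto c) (degreeInto (not ∘ c)) (members c) ⟩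
    ∑∈ c (degreeInto c) + ∑∈ c (degreeInto (not ∘ c))
      ≡⟨ cong₂ _+_ (pairsBetween≡∑∈ c c) (pairsBetween≡∑∈ c (not ∘ c)) ⟨
    pairsBetween c c + pairsBetween c (not ∘ c)
      ∎
    where open ≡-Reasoning

  pairsBetween-≤-∑∈-degree : ∀ c c′ → pairsBetween c c′ ≤ ∑∈ c (degree G)
  pairsBetween-≤-∑∈-degree c c′ =
    subst (_≤ ∑∈ c (degree G)) (sym (pairsBetween≡∑∈ c c′))
          (sum-map-filter-mono c (λ i _ → degreeInto-≤-degree c′ i) (allFin N))

  crossing-edge : ∀ {u v} → Walk G u v → (c : Fin N → Bool) → c u ≡ true → c v ≡ false →
                  ∃₂ λ x y → adj G x y ≡ true × c x ≡ true × c y ≡ false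
  crossing-edge here c cu cv with () ← trans (sym cu) cv
  crossing-edge {u} (step {w = w} uw W) c cu cv with c w in cw
  ... | true  = crossing-edge W c cw cv
  ... | false = u , w , uw , cu , cw

  pairsBetween-pos : ∀ {c c′ x y} → adj G x y ≡ true → c x ≡ true → c′ y ≡ true → 1 ≤ pairsBetween c c′
  pairsBetween-pos {c} {c′} {x} {y} xy cx c′y = begin
    1                                             ≡⟨ cong b2n (cong₂ _∧_ xy (cong₂ _∧_ cx c′y)) ⟨
    b2n (adj G x y ∧ c x ∧ c′ y)                  ≤⟨ ∈⇒≤sum-map _ (∈-allFin y) ⟩
    ∑ (λ j → b2n (adj G x j ∧ c x ∧ c′ j))        ≤⟨ ∈⇒≤sum-map _ (∈-allFin x) ⟩
    pairsBetween c c′                             ∎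
    where open ≤-Reasoning

  m10-pos : Connected G → ∀ c → 1 ≤ count1 c → 1 ≤ count1 (not ∘ c) → 1 ≤ m10 G c
  m10-pos connected c n1>0 n0>0
    with u , cu ← sum-b2n-pos⇒∃ c (allFin N) n1>0
       | v , ¬cv ← sum-b2n-pos⇒∃ (not ∘ c) (allFin N) n0>0
    with x , y , xy , cx , cy ← crossing-edge (connected u v) c cu (not-injective ¬cv)
    = subst (1 ≤_) (sym (m10≡pairsBetween c)) (pairsBetween-pos {c} {not ∘ c} xy cx (cong not cy))

  twice-m11-≤-count1*count1∸1 : ∀ c → 2 * m11 G c ≤ count1 c * (count1 c ∸ 1)
  twice-m11-≤-count1*count1∸1 c = subst (_≤ _) (sym (twice-m11≡pairsBetween c))
    (pairsBetween-≤-count1* c c _ (degreeInto-self-≤ c))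

  m10-≤-count1*N∸count1 : ∀ c → m10 G c ≤ count1 c * (N ∸ count1 c)
  m10-≤-count1*N∸count1 c = subst₂ _≤_ (sym (m10≡pairsBetween c)) (cong (count1 c *_) (count1-not≡∸ c))
    (pairsBetween-≤-count1* c (not ∘ c) _ (λ i _ → degreeInto-≤-count1 (not ∘ c) i))

module SortedDegrees {N} (G : Graph N) {ds : List ℕ}
                     (ds↭degrees : ds ↭ degreeList G) (sorted : Linked _≥_ ds) where

  length-ds : length ds ≡ N
  length-ds = trans (↭.↭-length ds↭degrees)
                    (trans (length-map (degree G) (allFin N)) (length-tabulate (λ i → i)))

  ∑∈-degree-≤-sum-take : (g : ℕ → ℕ) → (∀ {a b} → a ≤ b → g a ≤ g b) → ∀ c →
                         ∑∈ c (g ∘ degree G) ≤ sum (map g (take (count1 c) ds))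
  ∑∈-degree-≤-sum-take g g-mono c = begin
    ∑∈ c (g ∘ degree G)
      ≡⟨ cong sum (map-∘ (members c)) ⟩
    sum selected
      ≤⟨ sum-⊆-↭-sorted-≤ selected⊆ (↭.map⁺ g (↭-sym ds↭degrees)) (Linked.map⁺ (Linked.map g-mono sorted)) ⟩
    sum (take (length selected) (map g ds))
      ≡⟨ cong (λ k → sum (take k (map g ds))) length-selected ⟩
    sum (take (count1 c) (map g ds))
      ≡⟨ cong sum (take-map (count1 c) ds) ⟩
    sum (map g (take (count1 c) ds))
      ∎
    where
    open ≤-Reasoning
    selected : List ℕ
    selected = map g (map (degree G) (members c))
    selected⊆ : selected ⊆ map g (degreeList G)
    selected⊆ = map⁺ g (map⁺ (degree G) (filter-⊆ (T? ∘ c) (allFin N)))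
    length-selected : length selected ≡ count1 c
    length-selected = trans (length-map g (map (degree G) (members c)))
                     (trans (length-map (degree G) (members c)) (sym (count1≡length-members c)))

  pairsBetween-≤-sumLargestMin : ∀ c c′ b → (∀ i → c i ≡ true → degreeInto G c′ i ≤ b) →
                                 pairsBetween G c c′ ≤ sumLargestMin ds (count1 c) b
  pairsBetween-≤-sumLargestMin c c′ b bound = begin
    pairsBetween G c c′          ≡⟨ pairsBetween≡∑∈ G c c′ ⟩
    ∑∈ c (degreeInto G c′)       ≤⟨ sum-map-filter-mono c below-both (allFin N) ⟩
    ∑∈ c (λ i → degree G i ⊓ b)  ≤⟨ ∑∈-degree-≤-sum-take (_⊓ b) (⊓-monoˡ-≤ b) c ⟩
    sumLargestMin ds (count1 c) b ∎
    where
    open ≤-Reasoning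
    below-both : ∀ i → c i ≡ true → degreeInto G c′ i ≤ degree G i ⊓ b
    below-both i ci = ⊓-glb (degreeInto-≤-degree G c′ i) (bound i ci)

  ∑∈-degree-≤-sumLargest : ∀ c → ∑∈ c (degree G) ≤ sumLargest ds (count1 c)
  ∑∈-degree-≤-sumLargest c = subst (∑∈ c (degree G) ≤_) (cong sum (map-id (take (count1 c) ds)))
                                   (∑∈-degree-≤-sum-take (λ d → d) (λ a≤b → a≤b) c)

  sumSmallest-≤-∑∈-degree : ∀ c → sumSmallest ds (count1 c) ≤ ∑∈ c (degree G)
  sumSmallest-≤-∑∈-degree c =
    subst (λ k → sum (drop k ds) ≤ ∑∈ c (degree G)) (sym length-ds∸n1≡n0)
          (m+n≡o+p∧n≤o⇒p≤m sums≡ (∑∈-degree-≤-sumLargest (not ∘ c)))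
    where
    n0 : ℕ
    n0 = count1 (not ∘ c)
    length-ds∸n1≡n0 : length ds ∸ count1 c ≡ n0
    length-ds∸n1≡n0 = trans (cong (_∸ count1 c) length-ds) (sym (count1-not≡∸ c))
    sums≡ : ∑∈ c (degree G) + ∑∈ (not ∘ c) (degree G) ≡ sum (take n0 ds) + sum (drop n0 ds)
    sums≡ = begin
      ∑∈ c (degree G) + ∑∈ (not ∘ c) (degree G) ≡⟨ ∑∈-+-∑∈-not c (degree G) ⟩
      ∑ (degree G)                              ≡⟨ sum-↭ ds↭degrees ⟨
      sum ds                                    ≡⟨ cong sum (take++drop≡id n0 ds) ⟨
      sum (take n0 ds ++ drop n0 ds)            ≡⟨ sum-++ (take n0 ds) (drop n0 ds) ⟩
      sum (take n0 ds) + sum (drop n0 ds)       ∎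
      where open ≡-Reasoning

  twice-m11-≤-sumLargestMin : ∀ c → 2 * m11 G c ≤ sumLargestMin ds (count1 c) (count1 c ∸ 1)
  twice-m11-≤-sumLargestMin c = subst (_≤ _) (sym (twice-m11≡pairsBetween G c))
    (pairsBetween-≤-sumLargestMin c c (count1 c ∸ 1) (degreeInto-self-≤ G c))

  m10-≤-sumLargestMin : ∀ c → m10 G c ≤ sumLargestMin ds (count1 c) (N ∸ count1 c)
  m10-≤-sumLargestMin c =
    subst₂ _≤_ (sym (m10≡pairsBetween G c)) (cong (sumLargestMin ds (count1 c)) (count1-not≡∸ c))
    (pairsBetween-≤-sumLargestMin c (not ∘ c) _ (λ i _ → degreeInto-≤-count1 G (not ∘ c) i))

  m10-≤-sumLargestMin′ : ∀ c → m10 G c ≤ sumLargestMin ds (N ∸ count1 c) (count1 c)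
  m10-≤-sumLargestMin′ c =
    subst₂ _≤_ (sym (m10≡pairsBetween-not G c)) (cong (λ k → sumLargestMin ds k (count1 c)) (count1-not≡∸ c))
    (pairsBetween-≤-sumLargestMin (not ∘ c) c _ (λ i _ → degreeInto-≤-count1 G c i))

  sumSmallest-≤-twice-m11+m10 : ∀ c → sumSmallest ds (count1 c) ≤ 2 * m11 G c + m10 G c
  sumSmallest-≤-twice-m11+m10 c = subst (sumSmallest ds (count1 c) ≤_)
    (sym (cong₂ _+_ (twice-m11≡pairsBetween G c) (m10≡pairsBetween G c)))
    (≤-trans (sumSmallest-≤-∑∈-degree c) (≤-reflexive (∑∈-degree≡pairsBetween+pairsBetween G c)))

  sumSmallest-≤-sumLargest+twice-m11 : ∀ c →
    sumSmallest ds (count1 c) ≤ sumLargest ds (N ∸ count1 c) + 2 * m11 G c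
  sumSmallest-≤-sumLargest+twice-m11 c = begin
    sumSmallest ds (count1 c)                      ≤⟨ sumSmallest-≤-twice-m11+m10 c ⟩
    2 * m11 G c + m10 G c                          ≤⟨ +-monoʳ-≤ (2 * m11 G c) m10-≤-sumLargest-not ⟩
    2 * m11 G c + sumLargest ds (N ∸ count1 c)     ≡⟨ +-comm (2 * m11 G c) _ ⟩
    sumLargest ds (N ∸ count1 c) + 2 * m11 G c     ∎
    where
    open ≤-Reasoning
    m10-≤-sumLargest-not : m10 G c ≤ sumLargest ds (N ∸ count1 c)
    m10-≤-sumLargest-not =
      subst₂ _≤_ (sym (m10≡pairsBetween-not G c)) (cong (sumLargest ds) (count1-not≡∸ c))
      (≤-trans (pairsBetween-≤-∑∈-degree G (not ∘ c) c) (∑∈-degree-≤-sumLargest (not ∘ c)))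

  sumSmallest-≤-count1*count1∸1+m10 : ∀ c →
    sumSmallest ds (count1 c) ≤ count1 c * (count1 c ∸ 1) + m10 G c
  sumSmallest-≤-count1*count1∸1+m10 c =
    ≤-trans (sumSmallest-≤-twice-m11+m10 c) (+-monoˡ-≤ (m10 G c) (twice-m11-≤-count1*count1∸1 G c))

-- A separate module: with the prefix +_ of ℤ in scope, sections (x +_) of ℕ's _+_ are ambiguous.
module Arithmetic where

  open import Data.Integer as ℤ using (+_; -[1+_]; +[1+_]; +≤+)

  ℤtoℚ≡mkℚ : ∀ z → ℤtoℚ z ≡ mkℚ z 0 (Coprime.sym (Coprime.1-coprimeTo ℤ.∣ z ∣))
  ℤtoℚ≡mkℚ (+ n)    = ℚ.normalize-coprime (Coprime.sym (Coprime.1-coprimeTo n))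
  ℤtoℚ≡mkℚ -[1+ n ] = cong ℚ.-_ (ℚ.normalize-coprime (Coprime.sym (Coprime.1-coprimeTo (suc n))))

  ℤtoℚ-mono-≤ : ∀ {z w} → z ℤ.≤ w → ℤtoℚ z ℚ.≤ ℤtoℚ w
  ℤtoℚ-mono-≤ {z} {w} z≤w rewrite ℤtoℚ≡mkℚ z | ℤtoℚ≡mkℚ w =
    ℚ.*≤* (subst₂ ℤ._≤_ (sym (ℤ.*-identityʳ z)) (sym (ℤ.*-identityʳ w)) z≤w)

  ℕtoℚ-nonNeg : ∀ n → NonNegative (ℕtoℚ n)
  ℕtoℚ-nonNeg n = ℚ.normalize-nonNeg n 1

  1/-nonNeg : ∀ q .{{_ : ℚ.NonZero q}} → NonNegative q → NonNegative (ℚ.1/ q)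
  1/-nonNeg (mkℚ +[1+ n ] d coprime) _ = _

  ÷?-nonNeg : ∀ p q → NonNegative p → NonNegative q → NonNegative (p ÷? q)
  ÷?-nonNeg p q p≥0 q≥0 with q ℚ.≟ 0ℚ
  ... | yes _   = _
  ... | no q≢0 = ℚ.nonNeg*nonNeg⇒nonNeg p {{p≥0}} (ℚ.1/ q) {{1/-nonNeg q q≥0}}
    where instance _ = ℚ.≢-nonZero q≢0

  ÷?-monoˡ-≤ : ∀ {p p′} q → NonNegative q → p ℚ.≤ p′ → p ÷? q ℚ.≤ p′ ÷? q
  ÷?-monoˡ-≤ q q≥0 p≤p′ with q ℚ.≟ 0ℚ
  ... | yes _   = ℚ.≤-refl
  ... | no q≢0 = ℚ.*-monoʳ-≤-nonNeg (ℚ.1/ q) {{1/-nonNeg q q≥0}} p≤p′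
    where instance _ = ℚ.≢-nonZero q≢0

  ℤtoℚ-÷?-mono-≤ : ∀ q → NonNegative q → ∀ {z w} → z ℤ.≤ w → ℤtoℚ z ÷? q ℚ.≤ ℤtoℚ w ÷? q
  ℤtoℚ-÷?-mono-≤ q q≥0 = ÷?-monoˡ-≤ q q≥0 ∘ ℤtoℚ-mono-≤

  density-nonNeg : ∀ N M → NonNegative (density N M)
  density-nonNeg N M =
    ÷?-nonNeg (ℕtoℚ (2 * M)) (ℕtoℚ (N * (N ∸ 1))) (ℕtoℚ-nonNeg (2 * M)) (ℕtoℚ-nonNeg (N * (N ∸ 1)))

  mbar11-nonNeg : ∀ N M n1 → NonNegative (mbar11 N M n1)
  mbar11-nonNeg N M n1 =
    ℚ.nonNeg*nonNeg⇒nonNeg (ℕtoℚ (n1 * (n1 ∸ 1)) ÷? ℕtoℚ 2)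
      {{÷?-nonNeg (ℕtoℚ (n1 * (n1 ∸ 1))) (ℕtoℚ 2) (ℕtoℚ-nonNeg (n1 * (n1 ∸ 1))) (ℕtoℚ-nonNeg 2)}}
      (density N M) {{density-nonNeg N M}}

  mbar10-nonNeg : ∀ N M n1 → NonNegative (mbar10 N M n1)
  mbar10-nonNeg N M n1 =
    ℚ.nonNeg*nonNeg⇒nonNeg (ℕtoℚ (n1 * (N ∸ n1))) {{ℕtoℚ-nonNeg (n1 * (N ∸ n1))}}
                           (density N M) {{density-nonNeg N M}}

  +-∸-≤ : ∀ {a} c b → a ≤ c + b → + a ℤ.- + c ℤ.≤ + b
  +-∸-≤ {a} c b a≤c+b = begin
    + a ℤ.- + c   ≡⟨ ℤ.[+m]-[+n]≡m⊖n a c ⟩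
    a ℤ.⊖ c       ≤⟨ ℤ.⊖-monoˡ-≤ c a≤c+b ⟩
    (c + b) ℤ.⊖ c ≡⟨ ℤ.≤-⊖ (m≤m+n c b) ⟩
    + (c + b ∸ c) ≡⟨ cong +_ (m+n∸m≡n c b) ⟩
    + b           ∎
    where open ℤ.≤-Reasoning

  /ℕ2-≤ : ∀ z {m} → z ℤ.≤ + (2 * m) → z ℤ./ℕ 2 ℤ.≤ + m
  /ℕ2-≤ z {m} z≤2m = ℤ.*-cancelʳ-≤-pos (z ℤ./ℕ 2) (+ m) (+ 2) (begin
    z ℤ./ℕ 2 ℤ.* + 2 ≤⟨ ℤ.[n/ℕd]*d≤n z 2 ⟩
    z                ≤⟨ z≤2m ⟩
    + (2 * m)        ≡⟨ cong +_ (*-comm 2 m) ⟩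
    + (m * 2)        ≡⟨ ℤ.pos-* m 2 ⟩
    + m ℤ.* + 2      ∎)
    where open ℤ.≤-Reasoning

  ≤-/2 : ∀ {m x} → 2 * m ≤ x → m ≤ x ℕ./ 2
  ≤-/2 {m} {x} 2m≤x = subst (_≤ x ℕ./ 2) (trans (cong (ℕ._/ 2) (*-comm 2 m)) (m*n/n≡m m 2))
                            (/-monoˡ-≤ 2 2m≤x)

  LBm11-≤ : ∀ N M n1 ds m → sumSmallest ds n1 ≤ sumLargest ds (N ∸ n1) + 2 * m → LBm11 N M n1 ds ℤ.≤ + m
  LBm11-≤ N M n1 ds m bound =
    ℤ.⊔-lub (+≤+ z≤n) (/ℕ2-≤ (+ sumSmallest ds n1 ℤ.- + sumLargest ds (N ∸ n1))
                             (+-∸-≤ (sumLargest ds (N ∸ n1)) (2 * m) bound))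

  LBm10-≤ : ∀ N M n1 ds m → 1 ≤ m → sumSmallest ds n1 ≤ n1 * (n1 ∸ 1) + m → LBm10 N M n1 ds ℤ.≤ + m
  LBm10-≤ N M n1 ds m m>0 bound with n1 ℕ.≟ 0 | n1 ℕ.≟ N
  ... | yes _ | _     = +≤+ z≤n
  ... | no _  | yes _ = +≤+ z≤n
  ... | no _  | no _  = ℤ.⊔-lub (+≤+ m>0) (+-∸-≤ (n1 * (n1 ∸ 1)) m bound)

  UBm11-≥ : ∀ N M n1 ds m → m ≤ M → 2 * m ≤ n1 * (n1 ∸ 1) → 2 * m ≤ sumLargestMin ds n1 (n1 ∸ 1) →
            m ≤ UBm11 N M n1 ds
  UBm11-≥ N M n1 ds m m≤M by-pairs by-degrees =
    ⊓-glb m≤M (⊓-glb (≤-/2 by-pairs) (≤-/2 (≤-trans by-degrees (m≤m+n _ 1))))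

  UBm10-≥ : ∀ N M n1 ds m → m ≤ M → m ≤ n1 * (N ∸ n1) →
            m ≤ sumLargestMin ds n1 (N ∸ n1) → m ≤ sumLargestMin ds (N ∸ n1) n1 → m ≤ UBm10 N M n1 ds
  UBm10-≥ N M n1 ds m m≤M by-pairs by-degrees₁ by-degrees₀ =
    ⊓-glb m≤M (⊓-glb by-pairs (⊓-glb by-degrees₁ by-degrees₀))

open Arithmetic

proposition3p5 : (N : ℕ) → 2 ≤ N →
    (G : Graph N) → Connected G →
    1 ≤ numEdges G →
    (ds : List ℕ) → ds ↭ degreeList G → Linked _≥_ ds →
    (n1 : ℕ) → n1 ≤ N →
    (c : Fin N → Bool) → count1 c ≡ n1 →
    let M = numEdges G
        D = ℕtoℚ (m11 G c) ÷? mbar11 N M n1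
        H = ℕtoℚ (m10 G c) ÷? mbar10 N M n1
        Dmin = ℤtoℚ (LBm11 N M n1 ds) ÷? mbar11 N M n1
        Dmax = ℕtoℚ (UBm11 N M n1 ds) ÷? mbar11 N M n1
        Hmin = ℤtoℚ (LBm10 N M n1 ds) ÷? mbar10 N M n1
        Hmax = ℕtoℚ (UBm10 N M n1 ds) ÷? mbar10 N M n1
    in (2 ≤ n1 → (Dmin ≤ℚ D) × (D ≤ℚ Dmax))
       × (1 ≤ n1 → n1 ≤ N ∸ 1 → (Hmin ≤ℚ H) × (H ≤ℚ Hmax))
-- 2 ≤ N, 1 ≤ M and n1 ≤ N are not needed: ÷? by a non-negative number is monotone, including
-- its junk value 0 for a zero denominator.
proposition3p5 N _ G connected _ ds ds↭degrees sorted .(count1 c) _ c refl =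
  (λ _ → ÷mbar11-mono (LBm11-≤ N M n1 ds (m11 G c) (sumSmallest-≤-sumLargest+twice-m11 c))
       , ÷mbar11-mono (ℤ.+≤+ (UBm11-≥ N M n1 ds (m11 G c) (countEdgesWith-≤-numEdges G _)
                                (twice-m11-≤-count1*count1∸1 G c) (twice-m11-≤-sumLargestMin c))))
  , λ n1>0 n1≤N∸1 →
      ÷mbar10-mono (LBm10-≤ N M n1 ds (m10 G c)
                            (m10-pos G connected c n1>0 (count1-not-pos c n1>0 n1≤N∸1))
                            (sumSmallest-≤-count1*count1∸1+m10 c))
    , ÷mbar10-mono (ℤ.+≤+ (UBm10-≥ N M n1 ds (m10 G c) (countEdgesWith-≤-numEdges G _)
                                   (m10-≤-count1*N∸count1 G c)
                                   (m10-≤-sumLargestMin c) (m10-≤-sumLargestMin′ c)))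
  where
  open SortedDegrees G ds↭degrees sorted
  M n1 : ℕ
  M = numEdges G
  n1 = count1 c
  ÷mbar11-mono : ∀ {z w} → z ℤ.≤ w → ℤtoℚ z ÷? mbar11 N M n1 ≤ℚ ℤtoℚ w ÷? mbar11 N M n1
  ÷mbar11-mono = ℤtoℚ-÷?-mono-≤ (mbar11 N M n1) (mbar11-nonNeg N M n1)
  ÷mbar10-mono : ∀ {z w} → z ℤ.≤ w → ℤtoℚ z ÷? mbar10 N M n1 ≤ℚ ℤtoℚ w ÷? mbar10 N M n1
  ÷mbar10-mono = ℤtoℚ-÷?-mono-≤ (mbar10 N M n1) (mbar10-nonNeg N M n1)
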